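{- Let $B$ be a $k\times n$ $(0,1)$-matrix with no column of all 1's and no column of all 0's, and suppose that every pair of distinct rows of $B$ differs in at most $t$ columns. Then $n\le \frac{tk}{2}$. If moreover $B$ is simple and $t\ge 4$, then $$n\le \Big\lfloor 2k+\frac{(t-4)k(k-1)}{4(k-2)}\Big\rfloor.$$
   Context: A matrix is simple if it is a $(0,1)$-matrix with no repeated columns. -}

module Defs where

open import Data.Nat using (ℕ; zero; suc; _+_; _*_; _∸_; _/_; _≤_; s≤s; z≤n)
open import Data.Nat.DivMod
open import Data.Bool using (Bool; true; false)
import Data.Bool.Properties as BoolP
open import Data.Fin using (Fin)
open import Data.List using (length; filter; allFin)
open import Relation.Nullary using (¬?)
open import Relation.Binary.PropositionalEquality using (_≡_; _≢_)
open import Data.Product using (∃)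

-- A k × n (0,1)-matrix, entries encoded as Bool (false = 0, true = 1).
Matrix01 : ℕ → ℕ → Set
Matrix01 k n = Fin k → Fin n → Bool

differ : {n : ℕ} → (Fin n → Bool) → (Fin n → Bool) → ℕ
differ {n} x y = length (filter (λ j → ¬? (x j BoolP.≟ y j)) (allFin n))

NoAllOnesColumn : {k n : ℕ} → Matrix01 k n → Set
NoAllOnesColumn {k} {n} B = (j : Fin n) → ∃ λ (i : Fin k) → B i j ≡ false

NoAllZerosColumn : {k n : ℕ} → Matrix01 k n → Set
NoAllZerosColumn {k} {n} B = (j : Fin n) → ∃ λ (i : Fin k) → B i j ≡ true

RowsDifferAtMost : {k n : ℕ} → ℕ → Matrix01 k n → Set
RowsDifferAtMost {k} t B = (i i' : Fin k) → i ≢ i' → differ (B i) (B i') ≤ t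

Simple : {k n : ℕ} → Matrix01 k n → Set
Simple {k} {n} B = (j j' : Fin n) → ((i : Fin k) → B i j ≡ B i j') → j ≡ j'

-- ⌊ 2k + (t-4) k (k-1) / (4 (k-2)) ⌋, defined for k ≥ 3 (the denominator
-- vanishes for k = 2).  Since 2k is an integer, the floor of the sum equals
-- 2k + ⌊(t-4)k(k-1) / (4(k-2))⌋.  Used only under hypotheses t ≥ 4, k ≥ 3,
-- so t ∸ 4 and k ∸ 2 are the true differences.
bound : (k t : ℕ) → 3 ≤ k → ℕ
bound k@(suc (suc (suc m))) t _ = 2 * k + ((t ∸ 4) * k * (k ∸ 1)) / (4 * (k ∸ 2))
bound (suc zero) t (s≤s ())
bound (suc (suc zero)) t (s≤s (s≤s ()))

-- Double counting. Summing the Hamming distances over all ordered pairs of rows gives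
-- Σⱼ 2 aⱼ zⱼ, where column j has aⱼ ones and zⱼ zeros, aⱼ + zⱼ = k; the hypothesis bounds
-- the same sum by k (k - 1) t. As aⱼ, zⱼ ≥ 1 we have aⱼ zⱼ ≥ k - 1, whence n ≤ t k / 2.
-- When B is simple, aⱼ zⱼ ≥ 2 (k - 2) except for columns with a single 1 or a single 0,
-- which fall short by k - 3; there are at most k columns of each of these two kinds, so
-- 4 (k - 2) n ≤ k (k - 1) t + 4 k (k - 3), which is the second bound.
module Submission where

open import Defs
open import Data.Bool using (Bool; true; false; not; _∧_; _xor_; if_then_else_; T)
open import Data.Bool.Properties using (¬-not; xor-same; not-injective) renaming (_≟_ to _≟ᵇ_)
open import Data.Fin using (Fin; zero; suc; punchIn; punchOut) renaming (_≟_ to _≟ᶠ_)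
import Data.Fin.Properties as Fin
open import Data.List using (length; filter; tabulate)
open import Data.Nat using (ℕ; zero; suc; _+_; _*_; _/_; _≡ᵇ_; _≤_; NonZero; z≤n; s≤s; s≤s⁻¹)
open import Data.Nat.Properties
open import Data.Nat.DivMod using (m*n/n≡m; /-monoˡ-≤; +-distrib-/-∣ˡ)
open import Data.Nat.Divisibility using (n∣m*n)
open import Data.Nat.Tactic.RingSolver using (solve-∀)
open import Data.Product using (_×_; _,_)
open import Data.Unit using (tt)
open import Function using (_∘_)
open import Relation.Nullary using (¬?; does; yes; no; contradiction)
open import Relation.Unary using (Pred; Decidable)
open import Relation.Binary.PropositionalEquality
open import Algebra.Properties.Semiring.Sum +-*-semiring
  using (sum; sum-syntax; sum-cong-≗; sum-remove; sum-replicate-zero; ∑-comm; ∑-distrib-+;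
         *-distribˡ-sum; *-distribʳ-sum)

⟦_⟧ : Bool → ℕ
⟦ true ⟧ = 1
⟦ false ⟧ = 0

sum-mono-≤ : ∀ {n} {f g : Fin n → ℕ} → (∀ i → f i ≤ g i) → sum f ≤ sum g
sum-mono-≤ {zero} f≤g = z≤n
sum-mono-≤ {suc n} f≤g = +-mono-≤ (f≤g zero) (sum-mono-≤ (f≤g ∘ suc))

sum-const : ∀ n c → ∑[ i < n ] c ≡ n * c
sum-const zero c = refl
sum-const (suc n) c = cong (c +_) (sum-const n c)

sum-zero : ∀ {n} (f : Fin n → ℕ) → (∀ i → f i ≡ 0) → sum f ≡ 0
sum-zero {n} f f≡0 = trans (sum-cong-≗ f≡0) (sum-replicate-zero n)

f≤sum : ∀ {n} (f : Fin n → ℕ) i → f i ≤ sum f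
f≤sum {suc n} f i = ≤-trans (m≤m+n (f i) _) (≤-reflexive (sym (sum-remove {i = i} f)))

f+f≤sum : ∀ {n} (f : Fin n → ℕ) {i j} → i ≢ j → f i + f j ≤ sum f
f+f≤sum {suc n} f {i} {j} i≢j = begin
  f i + f j                            ≡⟨ cong (λ k → f i + f k) (Fin.punchIn-punchOut i≢j) ⟨
  f i + f (punchIn i (punchOut i≢j))   ≤⟨ +-monoʳ-≤ (f i) (f≤sum (f ∘ punchIn i) _) ⟩
  f i + ∑[ k < n ] f (punchIn i k)     ≡⟨ sum-remove {i = i} f ⟨
  sum f                                ∎
  where open ≤-Reasoning

sum≤-except : ∀ {n t} (f : Fin (suc n) → ℕ) {i} → f i ≡ 0 → (∀ j → j ≢ i → f j ≤ t) →
  sum f ≤ n * t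
sum≤-except {n} {t} f {i} fi≡0 f≤t = begin
  sum f                              ≡⟨ sum-remove {i = i} f ⟩
  f i + ∑[ k < n ] f (punchIn i k)   ≤⟨ +-mono-≤ (≤-reflexive fi≡0) (sum-mono-≤ f[punchIn]≤t) ⟩
  ∑[ k < n ] t                       ≡⟨ sum-const n t ⟩
  n * t                              ∎
  where
  open ≤-Reasoning
  f[punchIn]≤t : ∀ k → f (punchIn i k) ≤ t
  f[punchIn]≤t k = f≤t _ (Fin.punchInᵢ≢i i k)

∑⟦⟧≤1 : ∀ {n} (p : Fin n → Bool) → (∀ {j j'} → p j ≡ true → p j' ≡ true → j ≡ j') →
  ∑[ j < n ] ⟦ p j ⟧ ≤ 1
∑⟦⟧≤1 {zero} p unique = z≤n
∑⟦⟧≤1 {suc n} p unique with p zero in p0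
... | false = ∑⟦⟧≤1 (p ∘ suc) (λ pj pj' → Fin.suc-injective (unique pj pj'))
... | true = ≤-reflexive (cong suc (sum-zero (⟦_⟧ ∘ p ∘ suc) p[1+j]≡0))
  where
  p[1+j]≡0 : ∀ j → ⟦ p (suc j) ⟧ ≡ 0
  p[1+j]≡0 j = cong ⟦_⟧ (¬-not (λ pj → Fin.0≢1+n (unique p0 pj)))

length-filter-tabulate : ∀ {a p} {A : Set a} {P : Pred A p} (P? : Decidable P) {n} (f : Fin n → A) →
  length (filter P? (tabulate f)) ≡ ∑[ j < n ] ⟦ does (P? (f j)) ⟧
length-filter-tabulate P? {zero} f = refl
length-filter-tabulate P? {suc n} f with does (P? (f zero))
... | true = cong suc (length-filter-tabulate P? (f ∘ suc))
... | false = length-filter-tabulate P? (f ∘ suc)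

m+n≤1+m*n : ∀ {m n} → 1 ≤ m → 1 ≤ n → m + n ≤ suc (m * n)
m+n≤1+m*n {suc m} {suc n} _ _ = s≤s (begin
  m + suc n           ≡⟨ +-comm m (suc n) ⟩
  suc n + m           ≤⟨ +-monoʳ-≤ (suc n) (m≤m*n m (suc n)) ⟩
  suc n + m * suc n   ∎)
  where open ≤-Reasoning

m+n≡1+p⇒p≤m*n : ∀ {m n p} → m + n ≡ suc p → 1 ≤ m → 1 ≤ n → p ≤ m * n
m+n≡1+p⇒p≤m*n {m} {n} m+n≡1+p 1≤m 1≤n =
  s≤s⁻¹ (subst (_≤ suc (m * n)) m+n≡1+p (m+n≤1+m*n 1≤m 1≤n))

2*[m+n]≤[1+m]*[1+n] : ∀ {m n} → 1 ≤ m → 1 ≤ n → 2 * (m + n) ≤ suc m * suc n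
2*[m+n]≤[1+m]*[1+n] {m} {n} 1≤m 1≤n = begin
  2 * (m + n)             ≡⟨ double m n ⟩
  (m + n) + (m + n)       ≤⟨ +-monoˡ-≤ (m + n) (m+n≤1+m*n 1≤m 1≤n) ⟩
  suc (m * n) + (m + n)   ≡⟨ expand m n ⟨
  suc m * suc n           ∎
  where
  open ≤-Reasoning
  double : ∀ m n → 2 * (m + n) ≡ (m + n) + (m + n)
  double = solve-∀
  expand : ∀ m n → suc m * suc n ≡ suc (m * n) + (m + n)
  expand = solve-∀

-- With a + z = k = m + 3, a single 1 (a = 1) or a single 0 (z = 1) falls short of
-- a z ≥ 2 (k - 2) by exactly m; all other splits meet it.
a*z-bound : ∀ m {a z} → a + z ≡ 3 + m → 1 ≤ a → 1 ≤ z →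
  2 * suc m ≤ a * z + m * (⟦ a ≡ᵇ 1 ⟧ + ⟦ z ≡ᵇ 1 ⟧)
a*z-bound m {suc zero} refl _ _ = ≤-reflexive (single-one m)
  where
  single-one : ∀ m → 2 * suc m ≡ 1 * suc (suc m) + m * (1 + 0)
  single-one = solve-∀
a*z-bound m {a@(suc (suc _))} {suc zero} a+1≡3+m _ _
  with refl ← suc-injective (trans (+-comm 1 a) a+1≡3+m) = ≤-reflexive (single-zero m)
  where
  single-zero : ∀ m → 2 * suc m ≡ suc (suc m) * 1 + m * (0 + 1)
  single-zero = solve-∀
a*z-bound m {suc (suc a)} {suc (suc z)} a+z≡3+m _ _ = begin
  2 * suc m                                 ≡⟨ cong (2 *_) a+z≡1+m ⟨
  2 * (suc a + suc z)                       ≤⟨ 2*[m+n]≤[1+m]*[1+n] (s≤s z≤n) (s≤s z≤n) ⟩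
  suc (suc a) * suc (suc z)                 ≤⟨ m≤m+n _ _ ⟩
  suc (suc a) * suc (suc z) + m * (0 + 0)   ∎
  where
  open ≤-Reasoning
  a+z≡1+m : suc a + suc z ≡ suc m
  a+z≡1+m = trans (sym (+-suc a (suc z))) (suc-injective (suc-injective a+z≡3+m))

n*d≤c*d+x⇒n≤c+x/d : ∀ {n c x d} .{{_ : NonZero d}} → n * d ≤ c * d + x → n ≤ c + x / d
n*d≤c*d+x⇒n≤c+x/d {n} {c} {x} {d} n*d≤c*d+x = begin
  n                   ≡⟨ m*n/n≡m n d ⟨
  n * d / d           ≤⟨ /-monoˡ-≤ d n*d≤c*d+x ⟩
  (c * d + x) / d     ≡⟨ +-distrib-/-∣ˡ x (n∣m*n c) ⟩
  c * d / d + x / d   ≡⟨ cong (_+ x / d) (m*n/n≡m c d) ⟩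
  c + x / d           ∎
  where open ≤-Reasoning

ones : ∀ {k} → (Fin k → Bool) → ℕ
ones {k} c = ∑[ i < k ] ⟦ c i ⟧

zeros : ∀ {k} → (Fin k → Bool) → ℕ
zeros c = ones (not ∘ c)

ones+zeros≡length : ∀ {k} (c : Fin k → Bool) → ones c + zeros c ≡ k
ones+zeros≡length {k} c = begin
  ones c + zeros c                       ≡⟨ ∑-distrib-+ (⟦_⟧ ∘ c) (⟦_⟧ ∘ not ∘ c) ⟨
  ∑[ i < k ] (⟦ c i ⟧ + ⟦ not (c i) ⟧)   ≡⟨ sum-cong-≗ (λ i → ⟦b⟧+⟦notb⟧≡1 (c i)) ⟩
  ∑[ i < k ] 1                           ≡⟨ sum-const k 1 ⟩
  k * 1                                  ≡⟨ *-identityʳ k ⟩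
  k                                      ∎
  where
  open ≡-Reasoning
  ⟦b⟧+⟦notb⟧≡1 : ∀ b → ⟦ b ⟧ + ⟦ not b ⟧ ≡ 1
  ⟦b⟧+⟦notb⟧≡1 false = refl
  ⟦b⟧+⟦notb⟧≡1 true = refl

∑-if : ∀ {k} (c : Fin k → Bool) x y → ∑[ i < k ] (if c i then x else y) ≡ ones c * x + zeros c * y
∑-if {k} c x y = begin
  ∑[ i < k ] (if c i then x else y)
    ≡⟨ sum-cong-≗ (λ i → if≡ (c i)) ⟩
  ∑[ i < k ] (⟦ c i ⟧ * x + ⟦ not (c i) ⟧ * y)
    ≡⟨ ∑-distrib-+ (λ i → ⟦ c i ⟧ * x) (λ i → ⟦ not (c i) ⟧ * y) ⟩
  ∑[ i < k ] (⟦ c i ⟧ * x) + ∑[ i < k ] (⟦ not (c i) ⟧ * y)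
    ≡⟨ cong₂ _+_ (*-distribʳ-sum x (⟦_⟧ ∘ c)) (*-distribʳ-sum y (⟦_⟧ ∘ not ∘ c)) ⟨
  ones c * x + zeros c * y
    ∎
  where
  open ≡-Reasoning
  if≡ : ∀ b → (if b then x else y) ≡ ⟦ b ⟧ * x + ⟦ not b ⟧ * y
  if≡ true = sym (trans (+-identityʳ _) (+-identityʳ x))
  if≡ false = sym (+-identityʳ y)

∑∑xor≡2*ones*zeros : ∀ {k} (c : Fin k → Bool) →
  ∑[ i < k ] ∑[ i' < k ] ⟦ c i xor c i' ⟧ ≡ 2 * (ones c * zeros c)
∑∑xor≡2*ones*zeros {k} c = begin
  ∑[ i < k ] ∑[ i' < k ] ⟦ c i xor c i' ⟧
    ≡⟨ sum-cong-≗ (λ i → ∑xor≡ (c i)) ⟩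
  ∑[ i < k ] (if c i then zeros c else ones c)
    ≡⟨ ∑-if c (zeros c) (ones c) ⟩
  ones c * zeros c + zeros c * ones c
    ≡⟨ cong (ones c * zeros c +_) (trans (*-comm (zeros c) _) (sym (+-identityʳ _))) ⟩
  2 * (ones c * zeros c)
    ∎
  where
  open ≡-Reasoning
  ∑xor≡ : ∀ b → ∑[ i' < k ] ⟦ b xor c i' ⟧ ≡ (if b then zeros c else ones c)
  ∑xor≡ true = refl
  ∑xor≡ false = refl

ones≡1⇒unique : ∀ {k} {c : Fin k → Bool} → ones c ≡ 1 →
  ∀ {i i'} → c i ≡ true → c i' ≡ true → i ≡ i'
ones≡1⇒unique {c = c} ones≡1 {i} {i'} ci ci' with i ≟ᶠ i'
... | yes i≡i' = i≡i'
... | no i≢i' = contradiction 2≤1 λ { (s≤s ()) }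
  where
  2≤1 : 2 ≤ 1
  2≤1 = subst₂ (λ x y → ⟦ x ⟧ + ⟦ y ⟧ ≤ 1) ci ci'
    (≤-trans (f+f≤sum (⟦_⟧ ∘ c) i≢i') (≤-reflexive ones≡1))

ones≡1⇒indicator : ∀ {k} {c : Fin k → Bool} → ones c ≡ 1 →
  ∀ {i} → c i ≡ true → ∀ i' → c i' ≡ does (i ≟ᶠ i')
ones≡1⇒indicator ones≡1 {i} ci i' with i ≟ᶠ i'
... | yes refl = ci
... | no i≢i' = ¬-not (i≢i' ∘ ones≡1⇒unique ones≡1 ci)

differ≡∑xor : ∀ {n} (x y : Fin n → Bool) → differ x y ≡ ∑[ j < n ] ⟦ x j xor y j ⟧
differ≡∑xor x y =
  trans (length-filter-tabulate (λ j → ¬? (x j ≟ᵇ y j)) (λ j → j))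
        (sum-cong-≗ (λ j → cong ⟦_⟧ (≢?≡xor (x j) (y j))))
  where
  ≢?≡xor : ∀ a b → does (¬? (a ≟ᵇ b)) ≡ a xor b
  ≢?≡xor false false = refl
  ≢?≡xor false true = refl
  ≢?≡xor true false = refl
  ≢?≡xor true true = refl

differ-self : ∀ {n} (x : Fin n → Bool) → differ x x ≡ 0
differ-self x =
  trans (differ≡∑xor x x) (sum-zero (λ j → ⟦ x j xor x j ⟧) (λ j → cong ⟦_⟧ (xor-same (x j))))

column : ∀ {k n} → Matrix01 k n → Fin n → Fin k → Bool
column B j i = B i j

complement : ∀ {k n} → Matrix01 k n → Matrix01 k n
complement B i j = not (B i j)

totalDistance : ∀ {k n} → Matrix01 k n → ℕ
totalDistance {k} B = ∑[ i < k ] ∑[ i' < k ] differ (B i) (B i')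

differingPairs : ∀ {k n} → Matrix01 k n → ℕ
differingPairs {n = n} B = ∑[ j < n ] (ones (column B j) * zeros (column B j))

singletonColumns : ∀ {k n} → Matrix01 k n → ℕ
singletonColumns {n = n} B = ∑[ j < n ] ⟦ ones (column B j) ≡ᵇ 1 ⟧

totalDistance≡2*differingPairs : ∀ {k n} (B : Matrix01 k n) → totalDistance B ≡ 2 * differingPairs B
totalDistance≡2*differingPairs {k} {n} B = begin
  totalDistance B
    ≡⟨ sum-cong-≗ (λ i → sum-cong-≗ (λ i' → differ≡∑xor (B i) (B i'))) ⟩
  ∑[ i < k ] ∑[ i' < k ] ∑[ j < n ] ⟦ B i j xor B i' j ⟧
    ≡⟨ sum-cong-≗ (λ i → ∑-comm (λ i' j → ⟦ B i j xor B i' j ⟧)) ⟩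
  ∑[ i < k ] ∑[ j < n ] ∑[ i' < k ] ⟦ B i j xor B i' j ⟧
    ≡⟨ ∑-comm (λ i j → ∑[ i' < k ] ⟦ B i j xor B i' j ⟧) ⟩
  ∑[ j < n ] ∑[ i < k ] ∑[ i' < k ] ⟦ B i j xor B i' j ⟧
    ≡⟨ sum-cong-≗ (λ j → ∑∑xor≡2*ones*zeros (column B j)) ⟩
  ∑[ j < n ] (2 * (ones (column B j) * zeros (column B j)))
    ≡⟨ *-distribˡ-sum 2 (λ j → ones (column B j) * zeros (column B j)) ⟨
  2 * differingPairs B
    ∎
  where open ≡-Reasoning

totalDistance≤ : ∀ {p n t} (B : Matrix01 (suc p) n) → RowsDifferAtMost t B →
  totalDistance B ≤ suc p * (p * t)
totalDistance≤ {p} {t = t} B dist = begin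
  totalDistance B          ≤⟨ sum-mono-≤ row-bound ⟩
  ∑[ i < suc p ] (p * t)   ≡⟨ sum-const (suc p) (p * t) ⟩
  suc p * (p * t)          ∎
  where
  open ≤-Reasoning
  row-bound : ∀ i → ∑[ i' < suc p ] differ (B i) (B i') ≤ p * t
  row-bound i = sum≤-except _ (differ-self (B i)) (λ i' i'≢i → dist i i' (i'≢i ∘ sym))

2*differingPairs≤ : ∀ {p n t} (B : Matrix01 (suc p) n) → RowsDifferAtMost t B →
  2 * differingPairs B ≤ suc p * (p * t)
2*differingPairs≤ {p} {t = t} B dist =
  subst (_≤ suc p * (p * t)) (totalDistance≡2*differingPairs B) (totalDistance≤ B dist)

-- A singleton column is determined by the row of its 1, so each row is that row for at
-- most one of them.
singletonColumns≤rows : ∀ {k n} (B : Matrix01 k n) → Simple B → singletonColumns B ≤ k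
singletonColumns≤rows {k} {n} B simple = begin
  ∑[ j < n ] ⟦ singleton j ⟧                    ≡⟨ sum-cong-≗ split ⟩
  ∑[ j < n ] ∑[ i < k ] ⟦ singleton-at j i ⟧    ≡⟨ ∑-comm (λ j i → ⟦ singleton-at j i ⟧) ⟩
  ∑[ i < k ] ∑[ j < n ] ⟦ singleton-at j i ⟧    ≤⟨ sum-mono-≤ (λ i → ∑⟦⟧≤1 _ (unique-in-row i)) ⟩
  ∑[ i < k ] 1                                  ≡⟨ sum-const k 1 ⟩
  k * 1                                         ≡⟨ *-identityʳ k ⟩
  k                                             ∎
  where
  open ≤-Reasoning
  singleton : Fin n → Bool
  singleton j = ones (column B j) ≡ᵇ 1
  singleton⇒ones≡1 : ∀ {j} → singleton j ≡ true → ones (column B j) ≡ 1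
  singleton⇒ones≡1 {j} sj = ≡ᵇ⇒≡ (ones (column B j)) 1 (subst T (sym sj) tt)
  column-indicator : ∀ {i j} → singleton j ≡ true → B i j ≡ true → ∀ i' → B i' j ≡ does (i ≟ᶠ i')
  column-indicator sj Bij = ones≡1⇒indicator (singleton⇒ones≡1 sj) Bij
  singleton-at : Fin n → Fin k → Bool
  singleton-at j i = singleton j ∧ B i j
  split : ∀ j → ⟦ singleton j ⟧ ≡ ∑[ i < k ] ⟦ singleton-at j i ⟧
  split j with singleton j in sj
  ... | true = sym (singleton⇒ones≡1 sj)
  ... | false = sym (sum-replicate-zero k)
  ∧-true : ∀ {x y} → x ∧ y ≡ true → x ≡ true × y ≡ true
  ∧-true {true} {true} refl = refl , refl
  unique-in-row : ∀ i {j j'} → singleton-at j i ≡ true → singleton-at j' i ≡ true → j ≡ j'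
  unique-in-row i h h' with ∧-true h | ∧-true h'
  ... | sj , Bij | sj' , Bij' =
    simple _ _ (λ i' → trans (column-indicator sj Bij i') (sym (column-indicator sj' Bij' i')))

simple-complement : ∀ {k n} {B : Matrix01 k n} → Simple B → Simple (complement B)
simple-complement simple j j' same = simple j j' (λ i → not-injective (same i))

1≤ones : ∀ {k n} {B : Matrix01 k n} → NoAllZerosColumn B → ∀ j → 1 ≤ ones (column B j)
1≤ones {B = B} noZeros j with noZeros j
... | i , Bij≡true =
  subst (λ b → ⟦ b ⟧ ≤ ones (column B j)) Bij≡true (f≤sum (⟦_⟧ ∘ column B j) i)

1≤zeros : ∀ {k n} {B : Matrix01 k n} → NoAllOnesColumn B → ∀ j → 1 ≤ zeros (column B j)
1≤zeros noOnes = 1≤ones (λ j → let i , Bij≡false = noOnes j in i , cong not Bij≡false)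

2≤rows : ∀ {k n} {B : Matrix01 k n} → NoAllOnesColumn B → NoAllZerosColumn B → Fin n → 2 ≤ k
2≤rows {B = B} noOnes noZeros j =
  subst (2 ≤_) (ones+zeros≡length (column B j)) (+-mono-≤ (1≤ones noZeros j) (1≤zeros noOnes j))

n*p≤differingPairs : ∀ {p n} (B : Matrix01 (suc p) n) → NoAllOnesColumn B → NoAllZerosColumn B →
  n * p ≤ differingPairs B
n*p≤differingPairs {p} {n} B noOnes noZeros = begin
  n * p              ≡⟨ sum-const n p ⟨
  ∑[ j < n ] p       ≤⟨ sum-mono-≤ column-bound ⟩
  differingPairs B   ∎
  where
  open ≤-Reasoning
  column-bound : ∀ j → p ≤ ones (column B j) * zeros (column B j)
  column-bound j = m+n≡1+p⇒p≤m*n (ones+zeros≡length (column B j)) (1≤ones noZeros j) (1≤zeros noOnes j)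

n*2[1+m]≤differingPairs+m*singletons : ∀ {m n} (B : Matrix01 (3 + m) n) →
  NoAllOnesColumn B → NoAllZerosColumn B →
  n * (2 * suc m) ≤ differingPairs B + m * (singletonColumns B + singletonColumns (complement B))
n*2[1+m]≤differingPairs+m*singletons {m} {n} B noOnes noZeros = begin
  n * (2 * suc m)
    ≡⟨ sum-const n (2 * suc m) ⟨
  ∑[ j < n ] (2 * suc m)
    ≤⟨ sum-mono-≤ column-bound ⟩
  ∑[ j < n ] (a j * z j + m * e j)
    ≡⟨ ∑-distrib-+ (λ j → a j * z j) (λ j → m * e j) ⟩
  differingPairs B + ∑[ j < n ] (m * e j)
    ≡⟨ cong (differingPairs B +_) (*-distribˡ-sum m e) ⟨
  differingPairs B + m * sum e
    ≡⟨ cong (λ x → differingPairs B + m * x) (∑-distrib-+ (λ j → ⟦ a j ≡ᵇ 1 ⟧) (λ j → ⟦ z j ≡ᵇ 1 ⟧)) ⟩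
  differingPairs B + m * (singletonColumns B + singletonColumns (complement B))
    ∎
  where
  open ≤-Reasoning
  a z e : Fin n → ℕ
  a j = ones (column B j)
  z j = zeros (column B j)
  e j = ⟦ a j ≡ᵇ 1 ⟧ + ⟦ z j ≡ᵇ 1 ⟧
  column-bound : ∀ j → 2 * suc m ≤ a j * z j + m * e j
  column-bound j = a*z-bound m (ones+zeros≡length (column B j)) (1≤ones noZeros j) (1≤zeros noOnes j)

2*columns≤t*rows : ∀ {k n} t (B : Matrix01 k n) →
  NoAllOnesColumn B → NoAllZerosColumn B → RowsDifferAtMost t B → 2 * n ≤ t * k
2*columns≤t*rows {n = zero} _ _ _ _ _ = z≤n
2*columns≤t*rows {k} {n@(suc _)} t B noOnes noZeros dist with 2≤rows noOnes noZeros zero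
... | s≤s (s≤s {n = q} _) = *-cancelʳ-≤ (2 * n) (t * k) (suc q) (begin
  2 * n * suc q          ≡⟨ *-assoc 2 n (suc q) ⟩
  2 * (n * suc q)        ≤⟨ *-monoʳ-≤ 2 (n*p≤differingPairs B noOnes noZeros) ⟩
  2 * differingPairs B   ≤⟨ 2*differingPairs≤ B dist ⟩
  k * (suc q * t)        ≡⟨ reorder k (suc q) t ⟩
  t * k * suc q          ∎)
  where
  open ≤-Reasoning
  reorder : ∀ k p t → k * (p * t) ≡ t * k * p
  reorder = solve-∀

simple⇒columns≤bound : ∀ {k n} t (B : Matrix01 k n) → NoAllOnesColumn B → NoAllZerosColumn B →
  RowsDifferAtMost t B → Simple B → 4 ≤ t → (k≥3 : 3 ≤ k) → n ≤ bound k t k≥3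
simple⇒columns≤bound {k@(suc (suc (suc m)))} {n} t@(suc (suc (suc (suc s)))) B noOnes noZeros dist simple
  (s≤s (s≤s (s≤s (s≤s _)))) (s≤s (s≤s (s≤s _))) = n*d≤c*d+x⇒n≤c+x/d {c = 2 * k} (begin
    n * (4 * suc m)                             ≡⟨ regroup n m ⟩
    2 * (n * (2 * suc m))                       ≤⟨ *-monoʳ-≤ 2 columns-bound ⟩
    2 * (differingPairs B + m * E)              ≡⟨ *-distribˡ-+ 2 (differingPairs B) (m * E) ⟩
    2 * differingPairs B + 2 * (m * E)          ≤⟨ +-mono-≤ rows-bound (*-monoʳ-≤ 2 (*-monoʳ-≤ m E≤2k)) ⟩
    k * (suc (suc m) * t) + 2 * (m * (k + k))   ≡⟨ rearrange m s ⟩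
    2 * k * (4 * suc m) + s * k * suc (suc m)   ∎)
  where
  open ≤-Reasoning
  E : ℕ
  E = singletonColumns B + singletonColumns (complement B)
  columns-bound : n * (2 * suc m) ≤ differingPairs B + m * E
  columns-bound = n*2[1+m]≤differingPairs+m*singletons B noOnes noZeros
  rows-bound : 2 * differingPairs B ≤ k * (suc (suc m) * t)
  rows-bound = 2*differingPairs≤ B dist
  E≤2k : E ≤ k + k
  E≤2k = +-mono-≤ (singletonColumns≤rows B simple)
                  (singletonColumns≤rows (complement B) (simple-complement simple))
  regroup : ∀ n m → n * (4 * suc m) ≡ 2 * (n * (2 * suc m))
  regroup = solve-∀
  rearrange : ∀ m s → (3 + m) * ((2 + m) * (4 + s)) + 2 * (m * ((3 + m) + (3 + m)))
                    ≡ 2 * (3 + m) * (4 * suc m) + s * (3 + m) * (2 + m)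
  rearrange = solve-∀

mainTheorem9 : (k n t : ℕ) (B : Matrix01 k n) →
    NoAllOnesColumn B → NoAllZerosColumn B → RowsDifferAtMost t B →
    (2 * n ≤ t * k) ×
    (Simple B → 4 ≤ t → (k≥3 : 3 ≤ k) → n ≤ bound k t k≥3)
mainTheorem9 k n t B noOnes noZeros dist =
  2*columns≤t*rows t B noOnes noZeros dist , simple⇒columns≤bound t B noOnes noZeros dist
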